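{- Let $G$ and $H$ be finite simple graphs without vertices of degree 0, each of order at least three, and let $f=(V_0,V_1,V_2)$ be a $\gamma_{tR}(G\times H)$-function with $|V_2|$ as large as possible among all $\gamma_{tR}(G\times H)$-functions. The following are equivalent: (i) $G$ and $H$ are both triangle centered; (ii) $\gamma_{tR}(G\times H)=6$; (iii) $|V_1\cup V_2|=3$.
   Context: $G$ is triangle centered if it contains a triangle $xyz$ such that every vertex of $G$ is adjacent to at least two vertices of $\{x,y,z\}$. A function $f:V(G)\to\{0,1,2\}$ with $V_i=f^{ -1}(i)$ is a total Roman dominating function if every vertex in $V_0$ has a neighbor in $V_2$ and the subgraph induced by $V_1\cup V_2$ has no isolated vertices; $\gamma_{tR}(G)$ is the minimum of $\sum_v f(v)$ over such $f$, and a $\gamma_{tR}(G)$-function is one attaining this minimum. The direct product $G\times H$ has vertex set $V(G)\times V(H)$, with $(g,h)(g',h')$ an edge iff $gg'\in E(G)$ and $hh'\in E(H)$. -}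

module Defs where

open import Data.Nat using (ℕ; _≤_; _+_)
open import Data.Bool using (Bool; true; false; T; _∧_; if_then_else_)
open import Data.Fin using (Fin)
open import Data.Nat.ListAction using (sum)
open import Data.List using (List; map; length; filter; allFin; cartesianProduct)
open import Data.Product using (Σ; ∃; ∃-syntax; _×_; _,_)
open import Data.Nat using (_≤?_; _≟_)
open import Relation.Binary.PropositionalEquality using (_≡_)

record Graph : Set where
  field
    order : ℕ
    adj   : Fin order → Fin order → Bool
    adj-sym : ∀ u v → adj u v ≡ adj v u
    adj-irr : ∀ v → adj v v ≡ false

open Graph public

Edge : (G : Graph) → Fin (order G) → Fin (order G) → Set
Edge G u v = T (adj G u v)

NoIsolated : Graph → Set
NoIsolated G = ∀ v → ∃[ u ] Edge G v u

b2n : Bool → ℕ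
b2n true = 1
b2n false = 0

TriangleCentered : Graph → Set
TriangleCentered G =
  Σ (Fin (order G)) λ x → Σ (Fin (order G)) λ y → Σ (Fin (order G)) λ z →
    Edge G x y × Edge G y z × Edge G x z ×
    (∀ v → 2 ≤ b2n (adj G v x) + b2n (adj G v y) + b2n (adj G v z))

-- A finite graph given abstractly: a vertex type, adjacency, and a list enumerating
-- every vertex exactly once (used for sums/cardinalities).
record FinGraph : Set₁ where
  field
    V     : Set
    A     : V → V → Bool
    verts : List V

open FinGraph public

_×ᵍ_ : Graph → Graph → FinGraph
G ×ᵍ H = record
  { V = Fin (order G) × Fin (order H)
  ; A = λ { (g , h) (g' , h') → adj G g g' ∧ adj H h h' }
  ; verts = cartesianProduct (allFin (order G)) (allFin (order H)) }

-- Total Roman dominating function f : V → {0,1,2}, encoded as ℕ-valued with f v ≤ 2.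
IsTRDF : (F : FinGraph) → (V F → ℕ) → Set
IsTRDF F f =
  (∀ v → f v ≤ 2) ×
  (∀ v → f v ≡ 0 → ∃[ u ] (T (A F v u) × f u ≡ 2)) ×
  (∀ v → 1 ≤ f v → ∃[ u ] (T (A F v u) × 1 ≤ f u))

weight : (F : FinGraph) → (V F → ℕ) → ℕ
weight F f = sum (map f (verts F))

γtR≡ : FinGraph → ℕ → Set
γtR≡ F k = (∃[ f ] (IsTRDF F f × weight F f ≡ k)) ×
           (∀ g → IsTRDF F g → k ≤ weight F g)

IsγtRFunction : (F : FinGraph) → (V F → ℕ) → Set
IsγtRFunction F f = IsTRDF F f × (∀ g → IsTRDF F g → weight F f ≤ weight F g)

card2 : (F : FinGraph) → (V F → ℕ) → ℕ
card2 F f = length (filter (λ v → f v ≟ 2) (verts F))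

card12 : (F : FinGraph) → (V F → ℕ) → ℕ
card12 F f = length (filter (λ v → 1 ≤? f v) (verts F))

module Submission where

-- The heart of the proof is one combinatorial fact (module Product.Light): a total Roman
-- dominating function f of weight ≤ 6 has weight exactly 6 and forces G and H to be
-- triangle centred. It is proved by a case analysis on the set V₂ of 2-vertices. With no
-- 2-vertex, with one, or with two in a common row or column of G × H, a whole row or
-- column cannot be dominated and is positive, which pushes the weight to 7. Two
-- 2-vertices in different rows and columns, or three 2-vertices, spend the whole budget
-- (together with at most two further positive vertices), so these few vertices dominate
-- G × H and their coordinates form the centring triangles. Conversely, centring
-- triangles xyz, x'y'z' give a TRDF of weight 6 with V₂ = {(x,x'), (y,y'), (z,z')}.
-- With the counting identity weight = |V₁ ∪ V₂| + |V₂| the three implications follow.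

open import Defs
open import Level using (0ℓ)
open import Function using (_∘_; Equivalence)
open import Data.Empty using (⊥; ⊥-elim)
open import Data.Unit using (tt)
open import Data.Bool using (true; false; T; if_then_else_)
open import Data.Bool.Properties using (T-∧)
open import Data.Nat using (ℕ; zero; suc; _+_; _*_; _≤_; z≤n; s≤s; _≟_; _≤?_)
open import Data.Nat.Properties
open import Data.Nat.ListAction using (sum)
open import Algebra.Properties.CommutativeSemigroup +-commutativeSemigroup using (interchange; x∙yz≈y∙xz)
open import Data.Fin using (Fin; zero; suc)
open import Data.Fin.Properties using (any?) renaming (_≟_ to _≟ᶠ_)
open import Data.Product using (Σ; ∃; _×_; _,_; proj₁; proj₂)
open import Data.Product.Properties using (≡-dec)
open import Data.Sum using (_⊎_; inj₁; inj₂)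
open import Data.List using (List; []; _∷_; map; length; filter; _++_; allFin; cartesianProduct)
open import Data.List.Properties using (length-++; length-map; length-tabulate)
open import Data.List.Relation.Unary.All as All using (All; []; _∷_)
open import Data.List.Relation.Unary.All.Properties using (¬Any⇒All¬; All¬⇒¬Any)
open import Data.List.Relation.Unary.Any using (Any; here; there)
open import Data.List.Relation.Unary.AllPairs using ([]; _∷_)
open import Data.List.Relation.Unary.Unique.Propositional using (Unique)
open import Data.List.Relation.Unary.Unique.Propositional.Properties using (allFin⁺; cartesianProduct⁺)
open import Data.List.Relation.Binary.Pointwise using (Pointwise; []; _∷_)
open import Data.List.Membership.Propositional using (_∈_; lose)
open import Data.List.Membership.Propositional.Properties using (∈-allFin; ∈-cartesianProduct⁺)
import Data.List.Membership.DecPropositional as DecMembership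
open import Relation.Nullary using (¬_; Dec; yes; no; does)
open import Relation.Nullary.Decidable using (¬?; _×-dec_; decidable-stable)
open import Relation.Unary using (Pred; Decidable)
open import Relation.Binary.Definitions using (DecidableEquality)
open import Relation.Binary.PropositionalEquality

total : {A : Set} → (A → ℕ) → List A → ℕ
total f xs = sum (map f xs)

module _ {A : Set} where

  total-mono : {f g : A → ℕ} (xs : List A) → (∀ v → f v ≤ g v) → total f xs ≤ total g xs
  total-mono []       f≤g = z≤n
  total-mono (x ∷ xs) f≤g = +-mono-≤ (f≤g x) (total-mono xs f≤g)

  total-cong : {f g : A → ℕ} (xs : List A) → All (λ v → f v ≡ g v) xs → total f xs ≡ total g xs
  total-cong []       []         = refl
  total-cong (x ∷ xs) (fx≡gx ∷ eqs) = cong₂ _+_ fx≡gx (total-cong xs eqs)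

  total-+ : (f g : A → ℕ) (xs : List A) → total (λ v → f v + g v) xs ≡ total f xs + total g xs
  total-+ f g []       = refl
  total-+ f g (x ∷ xs) = begin
    (f x + g x) + total (λ v → f v + g v) xs ≡⟨ cong (f x + g x +_) (total-+ f g xs) ⟩
    (f x + g x) + (total f xs + total g xs)  ≡⟨ interchange (f x) (g x) (total f xs) (total g xs) ⟩
    (f x + total f xs) + (g x + total g xs)  ∎
    where open ≡-Reasoning

  total-one : (xs : List A) → total (λ _ → 1) xs ≡ length xs
  total-one []       = refl
  total-one (x ∷ xs) = cong suc (total-one xs)

  LowerBounds : (A → ℕ) → List ℕ → List A → Set
  LowerBounds f = Pointwise (λ b v → b ≤ f v)

  total-lower : {f : A → ℕ} {bs : List ℕ} {L : List A} → LowerBounds f bs L → sum bs ≤ total f L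
  total-lower []         = z≤n
  total-lower (b≤ ∷ bs≤) = +-mono-≤ b≤ (total-lower bs≤)

  indicator : {P : Pred A 0ℓ} → Decidable P → A → ℕ
  indicator P? v = if does (P? v) then 1 else 0

  indicator-yes : {P : Pred A 0ℓ} (P? : Decidable P) {v : A} → P v → indicator P? v ≡ 1
  indicator-yes P? {v} Pv with P? v
  ... | yes _   = refl
  ... | no  ¬Pv = ⊥-elim (¬Pv Pv)

  length-filter-total : {P : Pred A 0ℓ} (P? : Decidable P) (xs : List A) →
                        length (filter P? xs) ≡ total (indicator P?) xs
  length-filter-total P? []       = refl
  length-filter-total P? (x ∷ xs) with does (P? x)
  ... | true  = cong suc (length-filter-total P? xs)
  ... | false = length-filter-total P? xs

module _ {A : Set} (_≟ᴬ_ : DecidableEquality A) where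

  erase : A → (A → ℕ) → A → ℕ
  erase x f v with v ≟ᴬ x
  ... | yes _ = 0
  ... | no  _ = f v

  erase-at : ∀ x f → erase x f x ≡ 0
  erase-at x f with x ≟ᴬ x
  ... | yes _   = refl
  ... | no  x≢x = ⊥-elim (x≢x refl)

  erase-away : ∀ x f v → v ≢ x → erase x f v ≡ f v
  erase-away x f v v≢x with v ≟ᴬ x
  ... | yes v≡x = ⊥-elim (v≢x v≡x)
  ... | no  _   = refl

  erase-≤ : ∀ x f v → erase x f v ≤ f v
  erase-≤ x f v with v ≟ᴬ x
  ... | yes _ = z≤n
  ... | no  _ = ≤-refl

  total-erase-absent : ∀ x f L → All (x ≢_) L → total (erase x f) L ≡ total f L
  total-erase-absent x f L x∉L = total-cong L (All.map (λ x≢v → erase-away x f _ (x≢v ∘ sym)) x∉L)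

  total-erase-member : ∀ {x xs} → x ∈ xs → ∀ f → f x + total (erase x f) xs ≤ total f xs
  total-erase-member {x} {x ∷ ys} (here refl) f rewrite erase-at x f =
    +-monoʳ-≤ (f x) (total-mono ys (erase-≤ x f))
  total-erase-member {x} {y ∷ ys} (there x∈ys) f = begin
    f x + (erase x f y + total (erase x f) ys) ≡⟨ x∙yz≈y∙xz (f x) (erase x f y) _ ⟩
    erase x f y + (f x + total (erase x f) ys) ≤⟨ +-mono-≤ (erase-≤ x f y) (total-erase-member x∈ys f) ⟩
    f y + total f ys                           ∎
    where open ≤-Reasoning

  total-erase-unique : ∀ {xs} → Unique xs → ∀ x f → total f xs ≤ f x + total (erase x f) xs
  total-erase-unique {[]}     _              x f = z≤n
  total-erase-unique {y ∷ ys} (y∉ys ∷ uniq) x f = by-cases (y ≟ᴬ x)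
    where
    open ≤-Reasoning
    by-cases : Dec (y ≡ x) → total f (y ∷ ys) ≤ f x + total (erase x f) (y ∷ ys)
    by-cases (yes refl) = begin
      f y + total f ys                           ≡⟨ cong (f y +_) (sym (total-erase-absent y f ys y∉ys)) ⟩
      f y + total (erase y f) ys                 ≡⟨ cong (λ a → f y + (a + total (erase y f) ys)) (sym (erase-at y f)) ⟩
      f y + (erase y f y + total (erase y f) ys) ∎
    by-cases (no y≢x) = begin
      f y + total f ys                           ≤⟨ +-monoʳ-≤ (f y) (total-erase-unique uniq x f) ⟩
      f y + (f x + total (erase x f) ys)         ≡⟨ x∙yz≈y∙xz (f y) (f x) _ ⟩
      f x + (f y + total (erase x f) ys)         ≡⟨ cong (λ a → f x + (a + total (erase x f) ys)) (sym (erase-away x f y y≢x)) ⟩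
      f x + (erase x f y + total (erase x f) ys) ∎

  total-sublist : ∀ {L xs} → Unique L → All (_∈ xs) L → ∀ f → total f L ≤ total f xs
  total-sublist {[]}    _              _             f = z≤n
  total-sublist {x ∷ L} {xs} (x∉L ∷ uniq) (x∈xs ∷ L⊆xs) f = begin
    f x + total f L            ≡⟨ cong (f x +_) (sym (total-erase-absent x f L x∉L)) ⟩
    f x + total (erase x f) L  ≤⟨ +-monoʳ-≤ (f x) (total-sublist uniq L⊆xs (erase x f)) ⟩
    f x + total (erase x f) xs ≤⟨ total-erase-member x∈xs f ⟩
    total f xs                 ∎
    where open ≤-Reasoning

  total-support : ∀ {xs} → Unique xs → ∀ L f → (∀ v → All (v ≢_) L → f v ≡ 0) → total f xs ≤ total f L
  total-support {xs} _    []      f vanish = ≤-reflexive (total-zero xs)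
    where
    total-zero : ∀ ys → total f ys ≡ 0
    total-zero []       = refl
    total-zero (y ∷ ys) = cong₂ _+_ (vanish y []) (total-zero ys)
  total-support {xs} uniq (x ∷ L) f vanish = begin
    total f xs                ≤⟨ total-erase-unique uniq x f ⟩
    f x + total (erase x f) xs ≤⟨ +-monoʳ-≤ (f x) (total-support uniq L (erase x f) erased-vanish) ⟩
    f x + total (erase x f) L  ≤⟨ +-monoʳ-≤ (f x) (total-mono L (erase-≤ x f)) ⟩
    f x + total f L            ∎
    where
    open ≤-Reasoning
    erased-vanish : ∀ v → All (v ≢_) L → erase x f v ≡ 0
    erased-vanish v v∉L with v ≟ᴬ x
    ... | yes _   = refl
    ... | no  v≢x = vanish v (v≢x ∷ v∉L)

module _ {A : Set} (_≟ᴬ_ : DecidableEquality A)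
         (search : ∀ {Q : Pred A 0ℓ} → Decidable Q → Dec (∃ Q))
         {P : Pred A 0ℓ} (P? : Decidable P) where

  data Census : Set where
    none  : (∀ u → ¬ P u) → Census
    one   : ∀ s → P s → (∀ u → P u → u ∈ s ∷ []) → Census
    two   : ∀ s t → P s → P t → s ≢ t → (∀ u → P u → u ∈ s ∷ t ∷ []) → Census
    three : ∀ s t r → P s → P t → P r → s ≢ t → s ≢ r → t ≢ r → Census

  census : Census
  census with search P?
  ... | no ∄s = none (λ u Pu → ∄s (u , Pu))
  ... | yes (s , Ps) with search (λ u → P? u ×-dec ¬? (u ≟ᴬ s))
  ...   | no ∄t = one s Ps (λ u Pu → here (decidable-stable (u ≟ᴬ s) (λ u≢s → ∄t (u , Pu , u≢s))))
  ...   | yes (t , Pt , t≢s) with search (λ u → P? u ×-dec (¬? (u ≟ᴬ s) ×-dec ¬? (u ≟ᴬ t)))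
  ...     | yes (r , Pr , r≢s , r≢t) = three s t r Ps Pt Pr (t≢s ∘ sym) (r≢s ∘ sym) (r≢t ∘ sym)
  ...     | no ∄r = two s t Ps Pt (t≢s ∘ sym) only
    where
    only : ∀ u → P u → u ∈ s ∷ t ∷ []
    only u Pu with u ≟ᴬ s | u ≟ᴬ t
    ... | yes u≡s | _       = here u≡s
    ... | no _    | yes u≡t = there (here u≡t)
    ... | no u≢s  | no u≢t  = ⊥-elim (∄r (u , Pu , u≢s , u≢t))

length-cartesianProduct : ∀ {A B : Set} (xs : List A) (ys : List B) →
                          length (cartesianProduct xs ys) ≡ length xs * length ys
length-cartesianProduct []       ys = refl
length-cartesianProduct (x ∷ xs) ys = begin
  length (map (x ,_) ys ++ cartesianProduct xs ys)         ≡⟨ length-++ (map (x ,_) ys) ⟩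
  length (map (x ,_) ys) + length (cartesianProduct xs ys) ≡⟨ cong₂ _+_ (length-map (x ,_) ys) (length-cartesianProduct xs ys) ⟩
  length ys + length xs * length ys                        ∎
  where open ≡-Reasoning

module _ (F : FinGraph) (f : V F → ℕ) where

  private
    positive? : Decidable (λ v → 1 ≤ f v)
    positive? v = 1 ≤? f v
    two? : Decidable (λ v → f v ≡ 2)
    two? v = f v ≟ 2

  -- A value in {0,1,2} is the number of the conditions "≥ 1" and "= 2" it satisfies,
  -- so the weight of f is |V₁ ∪ V₂| + |V₂|.
  weight-split : (∀ v → f v ≤ 2) → weight F f ≡ card12 F f + card2 F f
  weight-split bounded = begin
    total f (verts F)                                                   ≡⟨ total-cong (verts F) (All.universal (λ v → digit (f v) (bounded v)) (verts F)) ⟩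
    total (λ v → indicator positive? v + indicator two? v) (verts F)    ≡⟨ total-+ (indicator positive?) (indicator two?) (verts F) ⟩
    total (indicator positive?) (verts F) + total (indicator two?) (verts F)
                                                                        ≡⟨ sym (cong₂ _+_ (length-filter-total positive? (verts F)) (length-filter-total two? (verts F))) ⟩
    card12 F f + card2 F f                                              ∎
    where
    open ≡-Reasoning
    digit : ∀ k → k ≤ 2 → k ≡ indicator (1 ≤?_) k + indicator (_≟ 2) k
    digit 0 _ = refl
    digit 1 _ = refl
    digit 2 _ = refl
    digit (suc (suc (suc _))) (s≤s (s≤s ()))

  card2≤card12 : card2 F f ≤ card12 F f
  card2≤card12 = begin
    card2 F f                              ≡⟨ length-filter-total two? (verts F) ⟩
    total (indicator two?) (verts F)       ≤⟨ total-mono (verts F) (λ v → two⇒positive (f v)) ⟩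
    total (indicator positive?) (verts F)  ≡⟨ sym (length-filter-total positive? (verts F)) ⟩
    card12 F f                             ∎
    where
    open ≤-Reasoning
    two⇒positive : ∀ k → indicator (_≟ 2) k ≤ indicator (1 ≤?_) k
    two⇒positive 0                   = z≤n
    two⇒positive 1                   = z≤n
    two⇒positive 2                   = ≤-refl
    two⇒positive (suc (suc (suc _))) = z≤n

  weight≤twice-card12 : (∀ v → f v ≤ 2) → weight F f ≤ card12 F f + card12 F f
  weight≤twice-card12 bounded =
    ≤-trans (≤-reflexive (weight-split bounded)) (+-monoʳ-≤ (card12 F f) card2≤card12)


module _ (K : Graph) where

  edge-irrefl : ∀ {u v} → Edge K u v → u ≢ v
  edge-irrefl {u} uv refl rewrite adj-irr K u = uv

  edge-sym : ∀ {u v} → Edge K u v → Edge K v u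
  edge-sym {u} {v} uv rewrite adj-sym K v u = uv

data TwoOf (P Q R : Set) : Set where
  first-second : P → Q → TwoOf P Q R
  first-third  : P → R → TwoOf P Q R
  second-third : Q → R → TwoOf P Q R

twoOf⇒count : ∀ {a b c} → TwoOf (T a) (T b) (T c) → 2 ≤ b2n a + b2n b + b2n c
twoOf⇒count {true}  {true}  {c}    (first-second _ _) = s≤s (s≤s z≤n)
twoOf⇒count {true}  {false} {true} (first-third _ _)  = s≤s (s≤s z≤n)
twoOf⇒count {true}  {true}  {true} (first-third _ _)  = s≤s (s≤s z≤n)
twoOf⇒count {false} {true}  {true} (second-third _ _) = s≤s (s≤s z≤n)
twoOf⇒count {true}  {true}  {true} (second-third _ _) = s≤s (s≤s z≤n)

count⇒twoOf : ∀ {a b c} → 2 ≤ b2n a + b2n b + b2n c → TwoOf (T a) (T b) (T c)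
count⇒twoOf {true}  {true}  {_}    _ = first-second tt tt
count⇒twoOf {true}  {false} {true} _ = first-third tt tt
count⇒twoOf {false} {true}  {true} _ = second-third tt tt
count⇒twoOf {true}  {false} {false} (s≤s ())
count⇒twoOf {false} {true}  {false} (s≤s ())
count⇒twoOf {false} {false} {true}  (s≤s ())
count⇒twoOf {false} {false} {false} ()

-- Two 2-element subsets of a 3-element index set share an index.
twoOf-common : ∀ {P₁ P₂ P₃ Q₁ Q₂ Q₃ : Set} → TwoOf P₁ P₂ P₃ → TwoOf Q₁ Q₂ Q₃ →
               (P₁ × Q₁) ⊎ (P₂ × Q₂) ⊎ (P₃ × Q₃)
twoOf-common (first-second p₁ _)  (first-second q₁ _)  = inj₁ (p₁ , q₁)
twoOf-common (first-second p₁ _)  (first-third q₁ _)   = inj₁ (p₁ , q₁)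
twoOf-common (first-second _ p₂)  (second-third q₂ _)  = inj₂ (inj₁ (p₂ , q₂))
twoOf-common (first-third p₁ _)   (first-second q₁ _)  = inj₁ (p₁ , q₁)
twoOf-common (first-third p₁ _)   (first-third q₁ _)   = inj₁ (p₁ , q₁)
twoOf-common (first-third _ p₃)   (second-third _ q₃)  = inj₂ (inj₂ (p₃ , q₃))
twoOf-common (second-third p₂ _)  (first-second _ q₂)  = inj₂ (inj₁ (p₂ , q₂))
twoOf-common (second-third _ p₃)  (first-third _ q₃)   = inj₂ (inj₂ (p₃ , q₃))
twoOf-common (second-third p₂ _)  (second-third q₂ _)  = inj₂ (inj₁ (p₂ , q₂))

twoOf-from-pairs : ∀ {P Q R : Set} → Q ⊎ R → P ⊎ R → P ⊎ Q → TwoOf P Q R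
twoOf-from-pairs (inj₁ q) (inj₁ p) _        = first-second p q
twoOf-from-pairs (inj₁ q) (inj₂ r) _        = second-third q r
twoOf-from-pairs (inj₂ r) _        (inj₁ p) = first-third p r
twoOf-from-pairs (inj₂ r) _        (inj₂ q) = second-third q r

third-vertex : ∀ {n} → 3 ≤ n → (x y : Fin n) → Σ (Fin n) λ z → z ≢ x × z ≢ y
third-vertex (s≤s (s≤s (s≤s _))) zero          zero          = suc zero , (λ ()) , (λ ())
third-vertex (s≤s (s≤s (s≤s _))) zero          (suc zero)    = suc (suc zero) , (λ ()) , (λ ())
third-vertex (s≤s (s≤s (s≤s _))) zero          (suc (suc _)) = suc zero , (λ ()) , (λ ())
third-vertex (s≤s (s≤s (s≤s _))) (suc zero)    zero          = suc (suc zero) , (λ ()) , (λ ())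
third-vertex (s≤s (s≤s (s≤s _))) (suc zero)    (suc _)       = zero , (λ ()) , (λ ())
third-vertex (s≤s (s≤s (s≤s _))) (suc (suc _)) zero          = suc zero , (λ ()) , (λ ())
third-vertex (s≤s (s≤s (s≤s _))) (suc (suc _)) (suc _)       = zero , (λ ()) , (λ ())

module _ (K : Graph) where

  private
    E : Fin (order K) → Fin (order K) → Set
    E = Edge K

  centred-intro : ∀ a c e → E a c → E c e → E a e →
                  (∀ v → v ≢ a → v ≢ c → v ≢ e → TwoOf (E v a) (E v c) (E v e)) →
                  TriangleCentered K
  centred-intro a c e ac ce ae outside = a , c , e , ac , ce , ae , λ v → twoOf⇒count (sees-two v)
    where
    sees-two : ∀ v → TwoOf (E v a) (E v c) (E v e)
    sees-two v with v ≟ᶠ a | v ≟ᶠ c | v ≟ᶠ e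
    ... | yes refl | _        | _        = second-third ac ae
    ... | no _     | yes refl | _        = first-third (edge-sym K ac) ce
    ... | no _     | no _     | yes refl = first-second (edge-sym K ae) (edge-sym K ce)
    ... | no v≢a   | no v≢c   | no v≢e   = outside v v≢a v≢c v≢e

  centred-by-edge : 3 ≤ order K → ∀ {a c} → E a c →
                    (∀ v → v ≢ a → v ≢ c → E v a × E v c) → TriangleCentered K
  centred-by-edge 3≤K {a} {c} ac both with third-vertex 3≤K a c
  ... | e , e≢a , e≢c with both e e≢a e≢c
  ...   | ea , ec = centred-intro a c e ac (edge-sym K ec) (edge-sym K ea)
                      (λ v v≢a v≢c _ → let (va , vc) = both v v≢a v≢c in first-second va vc)

value-2⇒positive : ∀ {k} → k ≡ 2 → 1 ≤ k
value-2⇒positive refl = s≤s z≤n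

module Product (G H : Graph) where

  F : FinGraph
  F = G ×ᵍ H

  Vertex : Set
  Vertex = Fin (order G) × Fin (order H)

  Adj : Vertex → Vertex → Set
  Adj u v = Edge G (proj₁ u) (proj₁ v) × Edge H (proj₂ u) (proj₂ v)

  adj⇒Adj : ∀ {u v : Vertex} → T (A F u v) → Adj u v
  adj⇒Adj {u} {v} = Equivalence.to (T-∧ {adj G (proj₁ u) (proj₁ v)} {adj H (proj₂ u) (proj₂ v)})

  Adj⇒adj : ∀ {u v : Vertex} → Adj u v → T (A F u v)
  Adj⇒adj {u} {v} = Equivalence.from (T-∧ {adj G (proj₁ u) (proj₁ v)} {adj H (proj₂ u) (proj₂ v)})

  Adj-sym : ∀ {u v} → Adj u v → Adj v u
  Adj-sym (gg' , hh') = edge-sym G gg' , edge-sym H hh'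

  _≟ᵛ_ : DecidableEquality Vertex
  _≟ᵛ_ = ≡-dec _≟ᶠ_ _≟ᶠ_

  open DecMembership _≟ᵛ_ using (_∈?_)

  ≢-fst : ∀ {a c : Fin (order G)} {b d : Fin (order H)} → a ≢ c → (a , b) ≢ (c , d)
  ≢-fst a≢c refl = a≢c refl

  ≢-snd : ∀ {a c : Fin (order G)} {b d : Fin (order H)} → b ≢ d → (a , b) ≢ (c , d)
  ≢-snd b≢d refl = b≢d refl

  search : ∀ {Q : Pred Vertex 0ℓ} → Decidable Q → Dec (∃ Q)
  search Q? with any? (λ g → any? (λ h → Q? (g , h)))
  ... | yes (g , h , q) = yes ((g , h) , q)
  ... | no ∄gh          = no λ { ((g , h) , q) → ∄gh (g , h , q) }

  vertices : List Vertex
  vertices = verts F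

  vertices-unique : Unique vertices
  vertices-unique = cartesianProduct⁺ (allFin⁺ (order G)) (allFin⁺ (order H))

  ∈-vertices : ∀ v → v ∈ vertices
  ∈-vertices (g , h) = ∈-cartesianProduct⁺ (∈-allFin g) (∈-allFin h)

  length-vertices : length vertices ≡ order G * order H
  length-vertices = trans (length-cartesianProduct (allFin (order G)) (allFin (order H)))
                          (cong₂ _*_ (length-tabulate {n = order G} (λ g → g)) (length-tabulate {n = order H} (λ h → h)))

  weight-≥ : ∀ {L} → Unique L → ∀ f → total f L ≤ weight F f
  weight-≥ {L} uniq f = total-sublist _≟ᵛ_ uniq (All.universal ∈-vertices L) f

  loopG : ∀ {g} → ¬ Edge G g g
  loopG gg = edge-irrefl G gg refl

  loopH : ∀ {h} → ¬ Edge H h h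
  loopH hh = edge-irrefl H hh refl

  Adj-irrefl : ∀ {v} → ¬ Adj v v
  Adj-irrefl (gg , _) = loopG gg

  Centred : Set
  Centred = TriangleCentered G × TriangleCentered H

  Dominate3 : Vertex → Vertex → Vertex → Set
  Dominate3 p q r = ∀ v → Adj v p ⊎ Adj v q ⊎ Adj v r

  rotate : ∀ {p q r} → Dominate3 p q r → Dominate3 q r p
  rotate dom v with dom v
  ... | inj₁ vp        = inj₂ (inj₂ vp)
  ... | inj₂ (inj₁ vq) = inj₁ vq
  ... | inj₂ (inj₂ vr) = inj₂ (inj₁ vr)

  -- If p = (a,b) dominates together with q = (c,d), r = (e,k) and is adjacent to both,
  -- then ace and bdk are centring triangles: each vertex (v,x) sharing a coordinate
  -- with one of p, q, r must be dominated by one of the other two.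
  centred-from-hub : ∀ {p q r} → Dominate3 p q r → Adj p q → Adj p r → Centred
  centred-from-hub {a , b} {c , d} {e , k} dom (ac , bd) (ae , bk) =
    centred-intro G a c e ac ce ae (λ v _ _ _ → g-sees v) ,
    centred-intro H b d k bd dk bk (λ x _ _ _ → h-sees x)
    where
    ce : Edge G c e
    ce with dom (c , b)
    ... | inj₁ (_ , bb)        = ⊥-elim (loopH bb)
    ... | inj₂ (inj₁ (cc , _)) = ⊥-elim (loopG cc)
    ... | inj₂ (inj₂ (ce , _)) = ce

    dk : Edge H d k
    dk with dom (a , d)
    ... | inj₁ (aa , _)        = ⊥-elim (loopG aa)
    ... | inj₂ (inj₁ (_ , dd)) = ⊥-elim (loopH dd)
    ... | inj₂ (inj₂ (_ , dk)) = dk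

    g-sees : ∀ v → TwoOf (Edge G v a) (Edge G v c) (Edge G v e)
    g-sees v = twoOf-from-pairs (not-first (dom (v , b))) (not-second (dom (v , d))) (not-third (dom (v , k)))
      where
      not-first : Adj (v , b) (a , b) ⊎ Adj (v , b) (c , d) ⊎ Adj (v , b) (e , k) → Edge G v c ⊎ Edge G v e
      not-first (inj₁ (_ , bb))        = ⊥-elim (loopH bb)
      not-first (inj₂ (inj₁ (vc , _))) = inj₁ vc
      not-first (inj₂ (inj₂ (ve , _))) = inj₂ ve
      not-second : Adj (v , d) (a , b) ⊎ Adj (v , d) (c , d) ⊎ Adj (v , d) (e , k) → Edge G v a ⊎ Edge G v e
      not-second (inj₁ (va , _))        = inj₁ va
      not-second (inj₂ (inj₁ (_ , dd))) = ⊥-elim (loopH dd)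
      not-second (inj₂ (inj₂ (ve , _))) = inj₂ ve
      not-third : Adj (v , k) (a , b) ⊎ Adj (v , k) (c , d) ⊎ Adj (v , k) (e , k) → Edge G v a ⊎ Edge G v c
      not-third (inj₁ (va , _))        = inj₁ va
      not-third (inj₂ (inj₁ (vc , _))) = inj₂ vc
      not-third (inj₂ (inj₂ (_ , kk))) = ⊥-elim (loopH kk)

    h-sees : ∀ x → TwoOf (Edge H x b) (Edge H x d) (Edge H x k)
    h-sees x = twoOf-from-pairs (not-first (dom (a , x))) (not-second (dom (c , x))) (not-third (dom (e , x)))
      where
      not-first : Adj (a , x) (a , b) ⊎ Adj (a , x) (c , d) ⊎ Adj (a , x) (e , k) → Edge H x d ⊎ Edge H x k
      not-first (inj₁ (aa , _))        = ⊥-elim (loopG aa)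
      not-first (inj₂ (inj₁ (_ , xd))) = inj₁ xd
      not-first (inj₂ (inj₂ (_ , xk))) = inj₂ xk
      not-second : Adj (c , x) (a , b) ⊎ Adj (c , x) (c , d) ⊎ Adj (c , x) (e , k) → Edge H x b ⊎ Edge H x k
      not-second (inj₁ (_ , xb))        = inj₁ xb
      not-second (inj₂ (inj₁ (cc , _))) = ⊥-elim (loopG cc)
      not-second (inj₂ (inj₂ (_ , xk))) = inj₂ xk
      not-third : Adj (e , x) (a , b) ⊎ Adj (e , x) (c , d) ⊎ Adj (e , x) (e , k) → Edge H x b ⊎ Edge H x d
      not-third (inj₁ (_ , xb))        = inj₁ xb
      not-third (inj₂ (inj₁ (_ , xd))) = inj₂ xd
      not-third (inj₂ (inj₂ (ee , _))) = ⊥-elim (loopG ee)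

  -- Among three dominating vertices, each has a neighbour among the other two,
  -- so one of them is adjacent to both others.
  centred-from-triple : ∀ {p q r} → Dominate3 p q r → Centred
  centred-from-triple {p} {q} {r} dom with dom p | dom q | dom r
  ... | inj₁ pp        | _              | _              = ⊥-elim (Adj-irrefl pp)
  ... | _              | inj₂ (inj₁ qq) | _              = ⊥-elim (Adj-irrefl qq)
  ... | _              | _              | inj₂ (inj₂ rr) = ⊥-elim (Adj-irrefl rr)
  ... | inj₂ (inj₁ pq) | _              | inj₁ rp        = centred-from-hub dom pq (Adj-sym rp)
  ... | inj₂ (inj₁ pq) | _              | inj₂ (inj₁ rq) = centred-from-hub (rotate dom) (Adj-sym rq) (Adj-sym pq)
  ... | inj₂ (inj₂ pr) | inj₁ qp        | _              = centred-from-hub dom (Adj-sym qp) pr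
  ... | inj₂ (inj₂ pr) | inj₂ (inj₂ qr) | _              = centred-from-hub (rotate (rotate dom)) (Adj-sym pr) (Adj-sym qr)

  module Light (3≤G : 3 ≤ order G) (3≤H : 3 ≤ order H)
               (f : Vertex → ℕ) (f-trdf : IsTRDF F f) (light : weight F f ≤ 6) where

    positive-or-dominated : ∀ v → 1 ≤ f v ⊎ ∃ λ u → Adj v u × f u ≡ 2
    positive-or-dominated v with f v in fv
    ... | suc _ = inj₁ (s≤s z≤n)
    ... | zero with proj₁ (proj₂ f-trdf) v fv
    ...   | u , vu , fu≡2 = inj₂ (u , adj⇒Adj vu , fu≡2)

    supported : ∀ v → 1 ≤ f v → ∃ λ u → Adj v u × 1 ≤ f u
    supported v pos with proj₂ (proj₂ f-trdf) v pos
    ... | u , vu , fu≥1 = u , adj⇒Adj vu , fu≥1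

    Only : List Vertex → Set
    Only L = ∀ u → f u ≡ 2 → u ∈ L

    undominated⇒positive : ∀ {L v} → Only L → ¬ Any (Adj v) L → 1 ≤ f v
    undominated⇒positive {L} {v} only ¬dom with positive-or-dominated v
    ... | inj₁ pos             = pos
    ... | inj₂ (u , vu , fu≡2) = ⊥-elim (¬dom (lose (only u fu≡2) vu))

    overspent : ∀ {L bs} → Unique L → LowerBounds f bs L → 7 ≤ sum bs → ⊥
    overspent {L} uniq lower 7≤bs =
      <-irrefl refl (≤-trans 7≤bs (≤-trans (total-lower lower) (≤-trans (weight-≥ uniq f) light)))

    record Exhausting (L : List Vertex) : Set where
      constructor exhausting
      field
        unique : Unique L
        {bounds} : List ℕ
        lower  : LowerBounds f bounds L
        six    : 6 ≤ sum bounds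

    module _ {L : List Vertex} (exh : Exhausting L) where
      open Exhausting exh

      -- Such a list contains every positive vertex …
      positive-in : ∀ {v} → 1 ≤ f v → v ∈ L
      positive-in {v} pos with v ∈? L
      ... | yes v∈L = v∈L
      ... | no  v∉L = ⊥-elim (overspent (¬Any⇒All¬ L v∉L ∷ unique) (pos ∷ lower) (s≤s six))

      -- … so a vertex off the list has value 0 and is dominated by a 2-vertex …
      off-list-dominated : ∀ {S v} → Only S → All (v ≢_) L → Any (Adj v) S
      off-list-dominated {S} {v} only v∉L with positive-or-dominated v
      ... | inj₁ pos             = ⊥-elim (All¬⇒¬Any v∉L (positive-in pos))
      ... | inj₂ (u , vu , fu≡2) = lose (only u fu≡2) vu

      -- … and hence a neighbour of every vertex: it totally dominates G × H.
      neighbour-in : ∀ v → Any (Adj v) L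
      neighbour-in v with positive-or-dominated v
      ... | inj₁ pos with supported v pos
      ...   | u , vu , fu≥1 = lose (positive-in fu≥1) vu
      neighbour-in v | inj₂ (u , vu , fu≡2) = lose (positive-in (value-2⇒positive fu≡2)) vu

      weight-≥6 : 6 ≤ weight F f
      weight-≥6 = ≤-trans six (≤-trans (total-lower lower) (weight-≥ unique f))

    -- Without 2-vertices every vertex is positive, so the weight is at least |V| ≥ 9.
    no-two : (∀ v → f v ≢ 2) → ⊥
    no-two no-2 = <-irrefl refl (begin
      7                              ≤⟨ m≤n+m 7 2 ⟩
      9                              ≤⟨ *-mono-≤ 3≤G 3≤H ⟩
      order G * order H              ≡⟨ sym length-vertices ⟩
      length vertices                ≡⟨ sym (total-one vertices) ⟩
      total (λ _ → 1) vertices       ≤⟨ total-mono vertices all-positive ⟩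
      weight F f                     ≤⟨ light ⟩
      6                              ∎)
      where
      open ≤-Reasoning
      all-positive : ∀ v → 1 ≤ f v
      all-positive v with positive-or-dominated v
      ... | inj₁ pos             = pos
      ... | inj₂ (u , _ , fu≡2) = ⊥-elim (no-2 u fu≡2)

    -- A single 2-vertex (a,b) dominates neither its row nor its column, so these are
    -- positive; (a,b), two more row vertices, two more column vertices and a positive
    -- neighbour (c,d) of (a,b) carry weight 7.
    lone-two : ∀ {a b} → f (a , b) ≡ 2 → Only ((a , b) ∷ []) → ⊥
    lone-two {a} {b} fab only with supported (a , b) (value-2⇒positive fab)
    ... | (c , d) , (ac , bd) , fcd≥1 with third-vertex 3≤H b d | third-vertex 3≤G a c
    ...   | h , h≢b , h≢d | g , g≢a , g≢c =
      overspent uniq (≤-reflexive (sym fab) ∷ row d ∷ row h ∷ column c ∷ fcd≥1 ∷ column g ∷ []) ≤-refl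
      where
      a≢c = edge-irrefl G ac
      b≢d = edge-irrefl H bd
      row : ∀ x → 1 ≤ f (a , x)
      row x = undominated⇒positive only λ { (here (aa , _)) → loopG aa }
      column : ∀ y → 1 ≤ f (y , b)
      column y = undominated⇒positive only λ { (here (_ , bb)) → loopH bb }
      uniq : Unique ((a , b) ∷ (a , d) ∷ (a , h) ∷ (c , b) ∷ (c , d) ∷ (g , b) ∷ [])
      uniq = (≢-snd b≢d ∷ ≢-snd (h≢b ∘ sym) ∷ ≢-fst a≢c ∷ ≢-fst a≢c ∷ ≢-fst (g≢a ∘ sym) ∷ [])
           ∷ (≢-snd (h≢d ∘ sym) ∷ ≢-fst a≢c ∷ ≢-fst a≢c ∷ ≢-fst (g≢a ∘ sym) ∷ [])
           ∷ (≢-fst a≢c ∷ ≢-fst a≢c ∷ ≢-fst (g≢a ∘ sym) ∷ [])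
           ∷ (≢-snd b≢d ∷ ≢-fst (g≢c ∘ sym) ∷ [])
           ∷ (≢-fst (g≢c ∘ sym) ∷ [])
           ∷ [] ∷ []

    -- Two 2-vertices in one row a: the row is positive, and with a positive neighbour (e,k)
    -- of (a,b) and one more row vertex the budget is spent; but then (a,k) would need
    -- a neighbour in the row or at (e,k), i.e. a loop at a or at k.
    two-in-row : ∀ {a b d} → f (a , b) ≡ 2 → f (a , d) ≡ 2 → b ≢ d → Only ((a , b) ∷ (a , d) ∷ []) → ⊥
    two-in-row {a} {b} {d} fab fad b≢d only with supported (a , b) (value-2⇒positive fab)
    ... | (e , k) , (ae , bk) , fek≥1 with third-vertex 3≤H b d
    ...   | h , h≢b , h≢d = no-neighbour (neighbour-in exh (a , k))
      where
      a≢e = edge-irrefl G ae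
      row : ∀ x → 1 ≤ f (a , x)
      row x = undominated⇒positive only λ { (here (aa , _)) → loopG aa ; (there (here (aa , _))) → loopG aa }
      exh : Exhausting ((a , b) ∷ (a , d) ∷ (a , h) ∷ (e , k) ∷ [])
      exh = exhausting
        (  (≢-snd b≢d ∷ ≢-snd (h≢b ∘ sym) ∷ ≢-fst a≢e ∷ [])
         ∷ (≢-snd (h≢d ∘ sym) ∷ ≢-fst a≢e ∷ [])
         ∷ (≢-fst a≢e ∷ []) ∷ [] ∷ [])
        (≤-reflexive (sym fab) ∷ ≤-reflexive (sym fad) ∷ row h ∷ fek≥1 ∷ [])
        ≤-refl
      no-neighbour : ¬ Any (Adj (a , k)) ((a , b) ∷ (a , d) ∷ (a , h) ∷ (e , k) ∷ [])
      no-neighbour (here (aa , _))                         = loopG aa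
      no-neighbour (there (here (aa , _)))                 = loopG aa
      no-neighbour (there (there (here (aa , _))))         = loopG aa
      no-neighbour (there (there (there (here (_ , kk))))) = loopH kk

    -- The same argument for two 2-vertices in one column b.
    two-in-column : ∀ {a c b} → f (a , b) ≡ 2 → f (c , b) ≡ 2 → a ≢ c → Only ((a , b) ∷ (c , b) ∷ []) → ⊥
    two-in-column {a} {c} {b} fab fcb a≢c only with supported (a , b) (value-2⇒positive fab)
    ... | (e , k) , (ae , bk) , fek≥1 with third-vertex 3≤G a c
    ...   | g , g≢a , g≢c = no-neighbour (neighbour-in exh (e , b))
      where
      b≢k = edge-irrefl H bk
      column : ∀ y → 1 ≤ f (y , b)
      column y = undominated⇒positive only λ { (here (_ , bb)) → loopH bb ; (there (here (_ , bb))) → loopH bb }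
      exh : Exhausting ((a , b) ∷ (c , b) ∷ (g , b) ∷ (e , k) ∷ [])
      exh = exhausting
        (  (≢-fst a≢c ∷ ≢-fst (g≢a ∘ sym) ∷ ≢-snd b≢k ∷ [])
         ∷ (≢-fst (g≢c ∘ sym) ∷ ≢-snd b≢k ∷ [])
         ∷ (≢-snd b≢k ∷ []) ∷ [] ∷ [])
        (≤-reflexive (sym fab) ∷ ≤-reflexive (sym fcb) ∷ column g ∷ fek≥1 ∷ [])
        ≤-refl
      no-neighbour : ¬ Any (Adj (e , b)) ((a , b) ∷ (c , b) ∷ (g , b) ∷ (e , k) ∷ [])
      no-neighbour (here (_ , bb))                         = loopH bb
      no-neighbour (there (here (_ , bb)))                 = loopH bb
      no-neighbour (there (there (here (_ , bb))))         = loopH bb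
      no-neighbour (there (there (there (here (ee , _))))) = loopG ee

    -- Two 2-vertices (a,b), (c,d) in different rows and columns: (a,d) and (c,b) are positive
    -- and the four vertices spend the budget. Then (a,d) must see (c,b), and every vertex
    -- off these four is dominated by (a,b) or (c,d); both factors are centred by an edge.
    two-apart : ∀ {a b c d} → f (a , b) ≡ 2 → f (c , d) ≡ 2 → a ≢ c → b ≢ d →
                Only ((a , b) ∷ (c , d) ∷ []) → 6 ≤ weight F f × Centred
    two-apart {a} {b} {c} {d} fab fcd a≢c b≢d only =
      weight-≥6 exh ,
      centred-by-edge G 3≤G (proj₁ ac×db) (λ g g≢a g≢c → g-sees g g≢a g≢c) ,
      centred-by-edge H 3≤H (proj₂ ac×db) (λ x x≢d x≢b → x-sees x x≢b x≢d)
      where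
      c≢a = a≢c ∘ sym
      ad-positive : 1 ≤ f (a , d)
      ad-positive = undominated⇒positive only λ { (here (aa , _)) → loopG aa ; (there (here (_ , dd))) → loopH dd }
      cb-positive : 1 ≤ f (c , b)
      cb-positive = undominated⇒positive only λ { (here (_ , bb)) → loopH bb ; (there (here (cc , _))) → loopG cc }
      exh : Exhausting ((a , b) ∷ (c , d) ∷ (a , d) ∷ (c , b) ∷ [])
      exh = exhausting
        (  (≢-fst a≢c ∷ ≢-snd b≢d ∷ ≢-fst a≢c ∷ [])
         ∷ (≢-fst c≢a ∷ ≢-snd (b≢d ∘ sym) ∷ [])
         ∷ (≢-fst a≢c ∷ []) ∷ [] ∷ [])
        (≤-reflexive (sym fab) ∷ ≤-reflexive (sym fcd) ∷ ad-positive ∷ cb-positive ∷ [])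
        ≤-refl
      ac×db : Edge G a c × Edge H d b
      ac×db with neighbour-in exh (a , d)
      ... | here (aa , _)                     = ⊥-elim (loopG aa)
      ... | there (here (_ , dd))             = ⊥-elim (loopH dd)
      ... | there (there (here (aa , _)))     = ⊥-elim (loopG aa)
      ... | there (there (there (here ad~cb))) = ad~cb
      g-sees : ∀ g → g ≢ a → g ≢ c → Edge G g a × Edge G g c
      g-sees g g≢a g≢c = sees-a , sees-c
        where
        sees-c : Edge G g c
        sees-c with off-list-dominated exh {v = g , b} only (≢-fst g≢a ∷ ≢-fst g≢c ∷ ≢-fst g≢a ∷ ≢-fst g≢c ∷ [])
        ... | here (_ , bb)          = ⊥-elim (loopH bb)
        ... | there (here (gc , _))  = gc
        sees-a : Edge G g a
        sees-a with off-list-dominated exh {v = g , d} only (≢-fst g≢a ∷ ≢-fst g≢c ∷ ≢-fst g≢a ∷ ≢-fst g≢c ∷ [])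
        ... | here (ga , _)          = ga
        ... | there (here (_ , dd))  = ⊥-elim (loopH dd)
      x-sees : ∀ x → x ≢ b → x ≢ d → Edge H x d × Edge H x b
      x-sees x x≢b x≢d = sees-d , sees-b
        where
        sees-d : Edge H x d
        sees-d with off-list-dominated exh {v = a , x} only (≢-snd x≢b ∷ ≢-fst a≢c ∷ ≢-snd x≢d ∷ ≢-fst a≢c ∷ [])
        ... | here (aa , _)          = ⊥-elim (loopG aa)
        ... | there (here (_ , xd))  = xd
        sees-b : Edge H x b
        sees-b with off-list-dominated exh {v = c , x} only (≢-fst c≢a ∷ ≢-snd x≢d ∷ ≢-fst c≢a ∷ ≢-snd x≢b ∷ [])
        ... | here (_ , xb)          = xb
        ... | there (here (cc , _))  = ⊥-elim (loopG cc)

    -- Three 2-vertices spend the budget and form a total dominating set of G × H.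
    three-twos : ∀ {s t r} → f s ≡ 2 → f t ≡ 2 → f r ≡ 2 → s ≢ t → s ≢ r → t ≢ r →
                 6 ≤ weight F f × Centred
    three-twos {s} {t} {r} fs ft fr s≢t s≢r t≢r = weight-≥6 exh , centred-from-triple dominate
      where
      exh : Exhausting (s ∷ t ∷ r ∷ [])
      exh = exhausting ((s≢t ∷ s≢r ∷ []) ∷ (t≢r ∷ []) ∷ [] ∷ [])
                       (≤-reflexive (sym fs) ∷ ≤-reflexive (sym ft) ∷ ≤-reflexive (sym fr) ∷ []) ≤-refl
      dominate : Dominate3 s t r
      dominate v with neighbour-in exh v
      ... | here vs                 = inj₁ vs
      ... | there (here vt)         = inj₂ (inj₁ vt)
      ... | there (there (here vr)) = inj₂ (inj₂ vr)

    -- Case analysis on the set of 2-vertices: only the last two cases are possible.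
    centred : 6 ≤ weight F f × Centred
    centred with census _≟ᵛ_ search (λ v → f v ≟ 2)
    ... | none no-2                            = ⊥-elim (no-two no-2)
    ... | one _ fs only                        = ⊥-elim (lone-two fs only)
    ... | three _ _ _ fs ft fr s≢t s≢r t≢r     = three-twos fs ft fr s≢t s≢r t≢r
    ... | two (a , b) (c , d) fab fcd s≢t only with a ≟ᶠ c | b ≟ᶠ d
    ...   | yes refl | yes refl = ⊥-elim (s≢t refl)
    ...   | yes refl | no b≢d   = ⊥-elim (two-in-row fab fcd b≢d only)
    ...   | no a≢c   | yes refl = ⊥-elim (two-in-column fab fcd a≢c only)
    ...   | no a≢c   | no b≢d   = two-apart fab fcd a≢c b≢d only

  weight≥6 : 3 ≤ order G → 3 ≤ order H → ∀ f → IsTRDF F f → 6 ≤ weight F f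
  weight≥6 3≤G 3≤H f f-trdf with weight F f ≤? 6
  ... | yes light = proj₁ (Light.centred 3≤G 3≤H f f-trdf light)
  ... | no  heavy = <⇒≤ (≰⇒> heavy)

  light⇒centred : 3 ≤ order G → 3 ≤ order H → ∀ f → IsTRDF F f → weight F f ≤ 6 → Centred
  light⇒centred 3≤G 3≤H f f-trdf light = proj₂ (Light.centred 3≤G 3≤H f f-trdf light)

  -- Conversely, centring triangles xyz of G and x'y'z' of H give the TRDF with value 2
  -- exactly on (x,x'), (y,y'), (z,z'): these three vertices dominate G × H, and
  -- (x,x') is adjacent to the two others.
  module Construction {x y z : Fin (order G)} {x' y' z' : Fin (order H)}
                      (xy : Edge G x y) (yz : Edge G y z) (xz : Edge G x z)
                      (xy' : Edge H x' y') (xz' : Edge H x' z')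
                      (sees-G : ∀ g → TwoOf (Edge G g x) (Edge G g y) (Edge G g z))
                      (sees-H : ∀ h → TwoOf (Edge H h x') (Edge H h y') (Edge H h z')) where

    centres : List Vertex
    centres = (x , x') ∷ (y , y') ∷ (z , z') ∷ []

    centres-unique : Unique centres
    centres-unique = (≢-fst (edge-irrefl G xy) ∷ ≢-fst (edge-irrefl G xz) ∷ [])
                   ∷ (≢-fst (edge-irrefl G yz) ∷ []) ∷ [] ∷ []

    centres-dominate : Dominate3 (x , x') (y , y') (z , z')
    centres-dominate (g , h) = twoOf-common (sees-G g) (sees-H h)

    f₀ : Vertex → ℕ
    f₀ v with v ∈? centres
    ... | yes _ = 2
    ... | no  _ = 0

    f₀-centre : ∀ {v} → v ∈ centres → f₀ v ≡ 2
    f₀-centre {v} v∈ with v ∈? centres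
    ... | yes _ = refl
    ... | no v∉ = ⊥-elim (v∉ v∈)

    f₀-off : ∀ v → All (v ≢_) centres → f₀ v ≡ 0
    f₀-off v v∉ with v ∈? centres
    ... | yes v∈ = ⊥-elim (All¬⇒¬Any v∉ v∈)
    ... | no  _  = refl

    f₀-trdf : IsTRDF F f₀
    f₀-trdf = bounded , dominated , supported
      where
      bounded : ∀ v → f₀ v ≤ 2
      bounded v with v ∈? centres
      ... | yes _ = ≤-refl
      ... | no  _ = z≤n
      dominated : ∀ v → f₀ v ≡ 0 → ∃ λ u → T (A F v u) × f₀ u ≡ 2
      dominated v _ with centres-dominate v
      ... | inj₁ vp        = _ , Adj⇒adj vp , f₀-centre (here refl)
      ... | inj₂ (inj₁ vq) = _ , Adj⇒adj vq , f₀-centre (there (here refl))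
      ... | inj₂ (inj₂ vr) = _ , Adj⇒adj vr , f₀-centre (there (there (here refl)))
      supported : ∀ v → 1 ≤ f₀ v → ∃ λ u → T (A F v u) × 1 ≤ f₀ u
      supported v pos with v ∈? centres
      ... | yes (here refl)                 = _ , Adj⇒adj (xy , xy') , value-2⇒positive (f₀-centre (there (here refl)))
      ... | yes (there (here refl))         = _ , Adj⇒adj (edge-sym G xy , edge-sym H xy') , value-2⇒positive (f₀-centre (here refl))
      ... | yes (there (there (here refl))) = _ , Adj⇒adj (edge-sym G xz , edge-sym H xz') , value-2⇒positive (f₀-centre (here refl))
      ... | no  _                           = ⊥-elim (<-irrefl refl pos)

    f₀-on-centres : All (λ v → f₀ v ≡ 2) centres
    f₀-on-centres = f₀-centre (here refl) ∷ f₀-centre (there (here refl)) ∷ f₀-centre (there (there (here refl))) ∷ []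

    f₀-weight : weight F f₀ ≤ 6
    f₀-weight = ≤-trans (total-support _≟ᵛ_ vertices-unique centres f₀ f₀-off)
                        (≤-reflexive (total-cong centres f₀-on-centres))

    f₀-card2 : 3 ≤ card2 F f₀
    f₀-card2 = begin
      3                                   ≡⟨ sym (total-cong centres (All.map (indicator-yes is-two?) f₀-on-centres)) ⟩
      total (indicator is-two?) centres   ≤⟨ weight-≥ centres-unique (indicator is-two?) ⟩
      total (indicator is-two?) vertices  ≡⟨ sym (length-filter-total is-two? vertices) ⟩
      card2 F f₀                          ∎
      where
      open ≤-Reasoning
      is-two? : Decidable (λ v → f₀ v ≡ 2)
      is-two? v = f₀ v ≟ 2

  centred⇒light-function : Centred → ∃ λ f₀ → IsTRDF F f₀ × weight F f₀ ≤ 6 × 3 ≤ card2 F f₀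
  centred⇒light-function ((x , y , z , xy , yz , xz , sees-G) , (x' , y' , z' , xy' , _ , xz' , sees-H)) =
    f₀ , f₀-trdf , f₀-weight , f₀-card2
    where open Construction xy yz xz xy' xz' (count⇒twoOf ∘ sees-G) (count⇒twoOf ∘ sees-H)

theorem12 : (G H : Graph) →
            NoIsolated G → NoIsolated H →
            3 ≤ order G → 3 ≤ order H →
            (f : V (G ×ᵍ H) → ℕ) →
            IsγtRFunction (G ×ᵍ H) f →
            (∀ g → IsγtRFunction (G ×ᵍ H) g → card2 (G ×ᵍ H) g ≤ card2 (G ×ᵍ H) f) →
            ((TriangleCentered G × TriangleCentered H) → γtR≡ (G ×ᵍ H) 6) ×
            (γtR≡ (G ×ᵍ H) 6 → card12 (G ×ᵍ H) f ≡ 3) ×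
            (card12 (G ×ᵍ H) f ≡ 3 → TriangleCentered G × TriangleCentered H)
theorem12 G H _ _ 3≤G 3≤H f (f-trdf , f-minimum) f-max-V₂ = i⇒ii , ii⇒iii , iii⇒i
  where
  open Product G H

  lower-bound : ∀ g → IsTRDF F g → 6 ≤ weight F g
  lower-bound = weight≥6 3≤G 3≤H

  i⇒ii : Centred → γtR≡ F 6
  i⇒ii centred =
    let (f₀ , f₀-trdf , f₀≤6 , _) = centred⇒light-function centred
    in (f₀ , f₀-trdf , ≤-antisym f₀≤6 (lower-bound f₀ f₀-trdf)) , lower-bound

  -- That γtR-function has three 2-vertices, so f, maximising |V₂|, has as many.
  3≤card2 : Centred → 3 ≤ card2 F f
  3≤card2 centred =
    let (f₀ , f₀-trdf , f₀≤6 , 3≤card2-f₀) = centred⇒light-function centred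
    in ≤-trans 3≤card2-f₀ (f-max-V₂ f₀ (f₀-trdf , λ g g-trdf → ≤-trans f₀≤6 (lower-bound g g-trdf)))

  -- Under (ii) f has weight 6, hence centred factors and |V₂| ≥ 3; then
  -- |V₁ ∪ V₂| + |V₂| = 6 and |V₂| ≤ |V₁ ∪ V₂| leave |V₁ ∪ V₂| = 3.
  ii⇒iii : γtR≡ F 6 → card12 F f ≡ 3
  ii⇒iii ((g , g-trdf , g≡6) , _) = ≤-antisym card12≤3 (≤-trans 3≤V₂ (card2≤card12 F f))
    where
    f≤6 : weight F f ≤ 6
    f≤6 = ≤-trans (f-minimum g g-trdf) (≤-reflexive g≡6)
    3≤V₂ : 3 ≤ card2 F f
    3≤V₂ = 3≤card2 (light⇒centred 3≤G 3≤H f f-trdf f≤6)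
    card12≤3 : card12 F f ≤ 3
    card12≤3 = +-cancelʳ-≤ 3 (card12 F f) 3 (begin
      card12 F f + 3         ≤⟨ +-monoʳ-≤ (card12 F f) 3≤V₂ ⟩
      card12 F f + card2 F f ≡⟨ sym (weight-split F f (proj₁ f-trdf)) ⟩
      weight F f             ≤⟨ f≤6 ⟩
      6                      ∎)
      where open ≤-Reasoning

  -- |V₁ ∪ V₂| = 3 bounds the weight by 2 · 3 = 6.
  iii⇒i : card12 F f ≡ 3 → Centred
  iii⇒i card12≡3 = light⇒centred 3≤G 3≤H f f-trdf
    (≤-trans (weight≤twice-card12 F f (proj₁ f-trdf)) (≤-reflexive (cong₂ _+_ card12≡3 card12≡3)))
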